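{- For all integers $n \geq 10$, $\rho_{\mathbf{t}}^{\textsf{t}}(n) = \rho_{\mathbf{t}}(n) - 4$ if the first two binary digits of $n-3$ are $1$ and $0$, and $\rho_{\mathbf{t}}^{\textsf{t}}(n) = \rho_{\mathbf{t}}(n) - 2$ otherwise.
   Context: "Subword" means factor (contiguous block). The Thue–Morse word is $\mathbf{t} = \mathbf{t}_0 \mathbf{t}_1 \mathbf{t}_2 \cdots$, where $\mathbf{t}_n$ is the number of $1$'s in the binary expansion of $n$, taken modulo $2$. $\rho_{\mathbf{t}}(n)$ is the number of distinct length-$n$ subwords of $\mathbf{t}$. The Defant–Kravitz map $\textsf{tortoise}$ on finite words over a totally ordered alphabet (here $0<1$) is defined recursively: $\textsf{tortoise}(\varepsilon)=\varepsilon$; for a nonempty word $w$ whose largest letter $n$ occurs $k$ times, write $w = A_1 n A_2 n \cdots n A_{k+1}$ (each $A_i$ possibly empty, with all letters of $A_i$ smaller than $n$), and set $\textsf{tortoise}(w) = \textsf{tortoise}(A_1)\,\textsf{tortoise}(A_2)\, n\, \textsf{tortoise}(A_3)\, n \cdots n\, \textsf{tortoise}(A_k)\, n\, \textsf{tortoise}(A_{k+1})\, n$. Two words are tortoise-equivalent ($w\sim_{\textsf{t}} v$) if $\textsf{tortoise}(w)=\textsf{tortoise}(v)$. $\rho_{\mathbf{t}}^{\textsf{t}}(n)$ is the number of $\sim_{\textsf{t}}$-equivalence classes of the set of length-$n$ subwords of $\mathbf{t}$. -}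

module Defs where

open import Data.Nat using (ℕ; zero; suc; _+_; _⊔_; _%_)
open import Data.List using (List; []; _∷_; _++_; length; map; upTo; foldr; concatMap)
open import Data.Nat.ListAction using (sum)
open import Data.List.Membership.Propositional using (_∈_)
open import Data.List.Relation.Unary.All using (All)
open import Data.List.Relation.Unary.Any using (Any)
open import Data.List.Relation.Unary.AllPairs using (AllPairs)
open import Data.List.Relation.Unary.Unique.Propositional using (Unique)
open import Data.Digit using (toNatDigits)
open import Data.Product using (Σ; ∃; _×_)
open import Relation.Binary.PropositionalEquality using (_≡_)
open import Relation.Nullary using (¬_)
open import Relation.Nullary.Decidable using (does)
open import Data.Bool using (true; false)

Word : Set
Word = List ℕ

-- Binary expansion, most significant digit first (library: Data.Digit).
binary : ℕ → List ℕ
binary n = toNatDigits 2 n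

tm : ℕ → ℕ
tm n = sum (binary n) % 2

factorAt : ℕ → ℕ → Word
factorAt i m = map (λ j → tm (i + j)) (upTo m)

IsSubword : Word → Set
IsSubword w = ∃ λ i → factorAt i (length w) ≡ w

SubwordOfLength : ℕ → Word → Set
SubwordOfLength n w = length w ≡ n × IsSubword w

-- splitOn a w = [A₁, …, A_{k+1}] where w = A₁ a A₂ a ⋯ a A_{k+1}
-- (a occurs k times in w, no Aᵢ contains a).
splitOn : ℕ → Word → List Word
splitOn a [] = [] ∷ []
splitOn a (x ∷ w) with does (Data.Nat._≟_ x a) | splitOn a w
... | true  | bs       = [] ∷ bs
... | false | []       = (x ∷ []) ∷ []
... | false | (b ∷ bs) = (x ∷ b) ∷ bs

-- tortoiseBelow m w computes tortoise(w) for words all of whose letters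
-- are < m.  For w nonempty with largest letter n = m - 1 occurring k ≥ 1
-- times, w = A₁ n A₂ ⋯ n A_{k+1} and the output is
--   tortoise(A₁) tortoise(A₂) n tortoise(A₃) n ⋯ tortoise(A_{k+1}) n.
-- If m - 1 does not occur, splitOn returns [w] and we recurse to m - 1.
tortoiseBelow : ℕ → Word → Word
tortoiseRest : ℕ → List Word → Word
tortoiseBelow zero    w = []
tortoiseBelow (suc m) w with splitOn m w
... | []       = []
... | (A ∷ As) = tortoiseBelow m A ++ tortoiseRest m As
tortoiseRest m []       = []
tortoiseRest m (A ∷ As) = tortoiseBelow m A ++ (m ∷ []) ++ tortoiseRest m As

maxLetter : Word → ℕ
maxLetter = foldr _⊔_ 0

tortoise : Word → Word
tortoise w = tortoiseBelow (suc (maxLetter w)) w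

_∼t_ : Word → Word → Set
w ∼t v = tortoise w ≡ tortoise v

SubwordComplexity : ℕ → ℕ → Set
SubwordComplexity n k =
  Σ (List Word) λ L →
    Unique L × (∀ w → (w ∈ L → SubwordOfLength n w) × (SubwordOfLength n w → w ∈ L)) × length L ≡ k

-- ρ^t_t(n) = k : the set of length-n subwords of t has exactly k
-- ∼t-classes, witnessed by a list of k length-n subwords that are pairwise
-- non-equivalent and such that every length-n subword is equivalent to one.
TortoiseComplexity : ℕ → ℕ → Set
TortoiseComplexity n k =
  Σ (List Word) λ R →
    All (SubwordOfLength n) R × AllPairs (λ u v → ¬ (u ∼t v)) R ×
    (∀ w → SubwordOfLength n w → Any (λ r → w ∼t r) R) × length R ≡ k

data Starts10 : List ℕ → Set where
  starts10 : ∀ ds → Starts10 (1 ∷ 0 ∷ ds)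

-- Every factor of t of length ≥ 3 starts with 1, 01 or 001, because t has
-- no factor 000; on such binary words tortoise moves the first 1 to the end.
-- For factors of length n ≥ 10 this identifies two distinct factors only
-- when they are 01z and 10z (the other candidates, 100y with 001y and 010y
-- with 001y, never both occur), so ρ^t(n) = ρ(n) − s(n − 2), where s(k)
-- counts the swappable z of length k: those with 01z and 10z both
-- factors.  From t(2i) = t(i) and t(2i+1) = 1 − t(i), and since a factor of
-- length ≥ 5 fixes the parity of its positions (it contains a square aa,
-- which only occurs at odd positions), the swappable words of length k ≥ 9
-- are exactly the length-k prefixes of μ(z′) for swappable z′ of length
-- ⌈k/2⌉, where μ is the Thue–Morse morphism.  Hence s(k) = s(⌈k/2⌉), which
-- ends in s(5), …, s(8) = 4, 4, 2, 2, and halving k ∸ 1 keeps its two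
-- leading binary digits.  All facts about short factors are checked by
-- computation, using that a factor of length ≤ 2^k occurs before 6·2^k.

module Submission where

open import Defs
open import Data.Bool using (Bool; true; false; T)
open import Data.Bool.Properties using (T-≡)
open import Data.Empty using (⊥; ⊥-elim)
open import Data.List using (List; []; _∷_; _++_; length; map; take; drop; filter; deduplicate; applyUpTo; upTo)
open import Data.List.Membership.Propositional using (_∈_)
open import Data.List.Membership.Propositional.Properties
  using (∈-map⁺; ∈-map⁻; ∈-filter⁺; ∈-filter⁻; ∈-deduplicate⁺; ∈-deduplicate⁻; ∈-upTo⁺)
open import Data.List.Membership.Propositional.Properties.WithK using (unique∧set⇒bag)
open import Data.List.Properties
  using (++-assoc; ++-cancelʳ; ∷-injectiveˡ; ∷-injectiveʳ; ≡-dec; length-++; length-map; length-take; take++drop≡id)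
open import Data.List.Relation.Binary.BagAndSetEquality using (∼bag⇒↭)
open import Data.List.Relation.Binary.Permutation.Propositional.Properties using (↭-length)
open import Data.List.Relation.Unary.All as All using (All; []; _∷_)
open import Data.List.Relation.Unary.All.Properties using () renaming (drop⁺ to All-drop⁺)
open import Data.List.Relation.Unary.AllPairs as AllPairs using (AllPairs; []; _∷_)
import Data.List.Relation.Unary.AllPairs.Properties as AllPairs
open import Data.List.Relation.Unary.Any as Any using (Any; here; there)
open import Data.List.Relation.Unary.Unique.Propositional using (Unique)
import Data.List.Relation.Unary.Unique.Propositional.Properties as Unique
open import Data.Nat
  using (ℕ; zero; suc; _+_; _*_; _^_; _∸_; _≤_; _<_; _/_; _%_; _<ᵇ_; ⌈_/2⌉; ⌊_/2⌋; z≤n; s≤s; s≤s⁻¹; z<s; s<s; sz<ss; NonZero; parity)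
open import Data.Nat.DivMod
open import Data.Nat.Induction using (Acc; acc; <-wellFounded-fast; <-rec)
open import Data.Nat.ListAction using (sum)
open import Data.Nat.ListAction.Properties using (sum-++)
open import Data.Nat.Properties
open import Data.List.Membership.DecPropositional (≡-dec _≟_) using (_∈?_)
open import Data.List.Relation.Unary.Unique.DecPropositional (≡-dec _≟_) using (unique?)
open import Data.List.Relation.Unary.Unique.DecPropositional.Properties (≡-dec _≟_) using (deduplicate-!)
open import Data.Parity.Base using (0ℙ; 1ℙ) renaming (_+_ to _ℙ+_)
import Data.Parity.Properties as ℙ
open import Data.Product using (Σ; _×_; ∃; _,_; proj₁; proj₂)
open import Data.Sum using (_⊎_; inj₁; inj₂)
open import Function.Base using (_∘_; _∋_)
open import Function.Bundles using (_⇔_; mk⇔; Equivalence)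
open import Induction.WellFounded using (WfRec)
open import Relation.Binary.Definitions using (DecidableEquality)
open import Relation.Binary.PropositionalEquality
  using (_≡_; _≢_; refl; sym; trans; cong; cong₂; subst; subst₂; module ≡-Reasoning)
open import Relation.Nullary using (¬_; Dec; yes; no; does; ¬?; _×-dec_; _⊎-dec_; _→-dec_)
open import Relation.Nullary.Decidable using (from-yes)
open import Relation.Unary using (Decidable)

AllPairs-mapWithAll : ∀ {A : Set} {P : A → Set} {R S : A → A → Set} {xs} → All P xs → AllPairs R xs →
                      (∀ {x y} → P x → P y → R x y → S x y) → AllPairs S xs
AllPairs-mapWithAll []         []         f = []
AllPairs-mapWithAll (px ∷ pxs) (rx ∷ rxs) f = All.zipWith (λ (py , r) → f px py r) (pxs , rx) ∷ AllPairs-mapWithAll pxs rxs f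

length-filter-∁ : ∀ {A : Set} {P : A → Set} (P? : Decidable P) xs →
                  length (filter (¬? ∘ P?) xs) ≡ length xs ∸ length (filter P? xs)
length-filter-∁ P? xs = sym (trans (cong (_∸ length (filter P? xs)) (sym (split xs))) (m+n∸m≡n (length (filter P? xs)) _))
  where
  split : ∀ xs → length (filter P? xs) + length (filter (¬? ∘ P?) xs) ≡ length xs
  split []       = refl
  split (x ∷ xs) with P? x
  ... | yes _ = cong suc (split xs)
  ... | no  _ = trans (+-suc _ _) (cong suc (split xs))

unique-same-members⇒length≡ : ∀ {A : Set} {xs ys : List A} → Unique xs → Unique ys → (∀ {x} → x ∈ xs ⇔ x ∈ ys) →
                              length xs ≡ length ys
unique-same-members⇒length≡ ux uy same = ↭-length (∼bag⇒↭ (unique∧set⇒bag ux uy same))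

_≟w_ : DecidableEquality Word
_≟w_ = ≡-dec _≟_

Enumerates : (Word → Set) → List Word → Set
Enumerates P xs = Unique xs × (∀ w → (w ∈ xs → P w) × (P w → w ∈ xs))

-- `binary n` unfolds to the where-bound helper `aux` of `toNatDigits` (an
-- accumulating loop over an accessibility proof) and to its with-function;
-- neither can be named.  `DigitLoop` derives the halving law for any `F`, `G`
-- obeying their clauses (the first argument of both is the unused outer
-- argument of `toNatDigits`).

Loop : Set
Loop = ℕ → (q : ℕ) → Acc _<_ q → List ℕ → List ℕ

Branch : Set
Branch = ℕ → (q : ℕ) → WfRec _<_ (Acc _<_) (suc q) → List ℕ → Bool → List ℕ

record BinaryHalving : Set where
  field binary-halve : ∀ n → 0 < n / 2 → binary n ≡ binary (n / 2) ++ (n % 2 ∷ [])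

module DigitLoop
  (F : Loop) (G : Branch)
  (F-zero  : ∀ k a ys → F k 0 a ys ≡ 0 ∷ ys)
  (F-suc   : ∀ k q (w : WfRec _<_ (Acc _<_) (suc q)) ys → F k (suc q) (acc w) ys ≡ G k q w ys (0 <ᵇ suc q / 2))
  (G-true  : ∀ k q (w : WfRec _<_ (Acc _<_) (suc q)) ys →
             G k q w ys true ≡ F k (suc q / 2) (w {suc q / 2} (m/n<m (suc q) 2 sz<ss)) (suc q % 2 ∷ ys))
  (G-false : ∀ k q (w : WfRec _<_ (Acc _<_) (suc q)) ys → G k q w ys false ≡ suc q % 2 ∷ ys)
  (binary≡F : ∀ n → binary n ≡ F n n (<-wellFounded-fast n) [])
  where

  F-accumulates : ∀ k k′ q (a a′ : Acc _<_ q) ys → F k q a ys ≡ F k′ q a′ [] ++ ys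
  F-accumulates k k′ zero a a′ ys = trans (F-zero k a ys) (cong (_++ ys) (sym (F-zero k′ a′ [])))
  F-accumulates k k′ (suc q) (acc w) (acc w′) ys
    rewrite F-suc k q w ys | F-suc k′ q w′ [] with 0 <ᵇ suc q / 2
  ... | false = trans (G-false k q w ys) (cong (_++ ys) (sym (G-false k′ q w′ [])))
  ... | true  = begin
    G k q w ys true                        ≡⟨ G-true k q w ys ⟩
    F k h (w h<) (r ∷ ys)                  ≡⟨ F-accumulates k k′ h (w h<) (w′ h<) (r ∷ ys) ⟩
    F k′ h (w′ h<) [] ++ (r ∷ []) ++ ys    ≡⟨ ++-assoc (F k′ h (w′ h<) []) (r ∷ []) ys ⟨
    (F k′ h (w′ h<) [] ++ (r ∷ [])) ++ ys  ≡⟨ cong (_++ ys) (F-accumulates k′ k′ h (w′ h<) (w′ h<) (r ∷ [])) ⟨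
    F k′ h (w′ h<) (r ∷ []) ++ ys          ≡⟨ cong (_++ ys) (G-true k′ q w′ []) ⟨
    G k′ q w′ [] true ++ ys                ∎
    where
    open ≡-Reasoning
    h = suc q / 2
    r = suc q % 2
    h< : h < suc q
    h< = m/n<m (suc q) 2 sz<ss

  F-halve : ∀ k q (w : WfRec _<_ (Acc _<_) (suc q)) ys → 0 < suc q / 2 →
            F k (suc q) (acc w) ys ≡ F k (suc q / 2) (w {suc q / 2} (m/n<m (suc q) 2 sz<ss)) (suc q % 2 ∷ ys)
  F-halve k q w ys h>0 =
    trans (F-suc k q w ys) (trans (cong (G k q w ys) (Equivalence.to T-≡ (<⇒<ᵇ h>0))) (G-true k q w ys))

  binary-halve : ∀ n → 0 < n / 2 → binary n ≡ binary (n / 2) ++ (n % 2 ∷ [])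
  binary-halve (suc q) h>0 = begin
    binary (suc q)                                      ≡⟨ binary≡F (suc q) ⟩
    F (suc q) (suc q) (<-wellFounded-fast (suc q)) []   ≡⟨ F-halve (suc q) q _ [] h>0 ⟩
    F (suc q) h _ (r ∷ [])                              ≡⟨ F-accumulates (suc q) h h _ (<-wellFounded-fast h) _ ⟩
    F h h (<-wellFounded-fast h) [] ++ (r ∷ [])         ≡⟨ cong (_++ (r ∷ [])) (binary≡F h) ⟨
    binary h ++ (r ∷ [])                                ∎
    where
    open ≡-Reasoning
    h = suc q / 2
    r = suc q % 2

-- The real helpers are exposed by with-abstracting the hooks
-- `binary N₁ ≡ binary N₁` (one halving step deep, for `aux`) and
-- `binary N₂ ≡ binary N₂` (two steps deep, for its with-function) until they
-- occur applied to variables only; a with-bound `captured` then carries a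
-- metavariable, created outside the abstraction, that unification solves.
-- The halving law is wrapped in a record so that with-abstraction, which
-- normalises the goal, leaves it intact; the ascriptions `List ℕ ∋ …` are
-- needed because the overloaded `_∷_` would otherwise not be abstracted.
data Captured {A : Set} (x : A) : Set where
  captured : Captured x

capturedLoop : {F : Loop} → Captured F → (k q : ℕ) (a : Acc _<_ q) (ys : List ℕ) → F k q a ys ≡ F k q a ys → Loop
capturedLoop {F} _ _ _ _ _ _ = F

capturedBranch : {G : Branch} → Captured G → (k q : ℕ) (w : WfRec _<_ (Acc _<_) (suc q)) (ys : List ℕ) (b : Bool) →
                 G k q w ys b ≡ G k q w ys b → Branch
capturedBranch {G} _ _ _ _ _ _ _ = G

0<ᵇ-half : ∀ n → 0 < n / 2 → (0 <ᵇ n / 2) ≡ false → ⊥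
0<ᵇ-half n h>0 e = subst T e (<⇒<ᵇ h>0)

captureDigitLoop : ∀ N₁ N₂ → 0 < N₁ / 2 → 0 < N₂ / 2 → binary N₁ ≡ binary N₁ → binary N₂ ≡ binary N₂ → BinaryHalving
captureDigitLoop N₁ N₂ p₁ p₂ with <-wellFounded-fast N₁ | <-wellFounded-fast N₂
captureDigitLoop (suc n₁) (suc n₂) p₁ p₂ | acc w₁ | acc w₂ with 0 <ᵇ suc n₁ / 2 in e₁ | 0 <ᵇ suc n₂ / 2 in e₂
... | false | _     = ⊥-elim (0<ᵇ-half (suc n₁) p₁ e₁)
... | true  | false = ⊥-elim (0<ᵇ-half (suc n₂) p₂ e₂)
... | true  | true
  with captured {x = _} | captured {x = _}
     | suc n₁ | suc n₁ / 2 | w₁ (m/n<m (suc n₁) 2 sz<ss) | (List ℕ ∋ suc n₁ % 2 ∷ [])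
     | suc n₂ | suc n₂ / 2 in eq₂ | w₂ (m/n<m (suc n₂) 2 sz<ss) | (List ℕ ∋ suc n₂ % 2 ∷ [])
... | F | G | k₁ | q₁ | a₁ | ys₁ | k₂ | zero   | _        | ys₂ = ⊥-elim (n≮0 (subst (0 <_) eq₂ p₂))
... | F | G | k₁ | q₁ | a₁ | ys₁ | k₂ | suc q₂ | acc w₂′ | ys₂ with 0 <ᵇ suc q₂ / 2
... | b = λ d₁ d₂ → record { binary-halve = DigitLoop.binary-halve
  (capturedLoop F k₁ q₁ a₁ ys₁ d₁) (capturedBranch G k₂ q₂ w₂′ ys₂ b d₂)
  (λ _ _ _ → refl) (λ _ _ _ _ → refl) (λ _ _ _ _ → refl) (λ _ _ _ _ → refl) (λ _ → refl) }

open BinaryHalving (captureDigitLoop 2 2 (s≤s z≤n) (s≤s z≤n) refl refl)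

double : ℕ → ℕ
double zero    = zero
double (suc n) = suc (suc (double n))

data EvenOdd : ℕ → Set where
  even : ∀ c → EvenOdd (double c)
  odd  : ∀ c → EvenOdd (suc (double c))

evenOdd : ∀ n → EvenOdd n
evenOdd zero = even 0
evenOdd (suc n) with evenOdd n
... | even c = odd c
... | odd  c = even (suc c)

double/2 : ∀ c → double c / 2 ≡ c
double/2 zero    = refl
double/2 (suc c) = trans (m/n≡1+[m∸n]/n {double (suc c)} (s≤s (s≤s z≤n))) (cong suc (double/2 c))

double%2 : ∀ c → double c % 2 ≡ 0
double%2 zero    = refl
double%2 (suc c) = trans (sym (m≤n⇒[n∸m]%m≡n%m {n = double (suc c)} (s≤s (s≤s z≤n)))) (double%2 c)

1+double/2 : ∀ c → suc (double c) / 2 ≡ c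
1+double/2 zero    = refl
1+double/2 (suc c) = trans (m/n≡1+[m∸n]/n {suc (double (suc c))} (s≤s (s≤s z≤n))) (cong suc (1+double/2 c))

1+double%2 : ∀ c → suc (double c) % 2 ≡ 1
1+double%2 zero    = refl
1+double%2 (suc c) = trans (sym (m≤n⇒[n∸m]%m≡n%m {n = suc (double (suc c))} (s≤s (s≤s z≤n)))) (1+double%2 c)

double≡2* : ∀ n → double n ≡ 2 * n
double≡2* zero    = refl
double≡2* (suc n) = cong suc (trans (cong suc (double≡2* n)) (sym (+-suc n (n + 0))))

⌊double/2⌋ : ∀ c → ⌊ double c /2⌋ ≡ c
⌊double/2⌋ zero    = refl
⌊double/2⌋ (suc c) = cong suc (⌊double/2⌋ c)

⌊1+double/2⌋ : ∀ c → ⌊ suc (double c) /2⌋ ≡ c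
⌊1+double/2⌋ zero    = refl
⌊1+double/2⌋ (suc c) = cong suc (⌊1+double/2⌋ c)

≤double⌈/2⌉ : ∀ n → n ≤ double ⌈ n /2⌉
≤double⌈/2⌉ 0             = z≤n
≤double⌈/2⌉ 1             = s≤s z≤n
≤double⌈/2⌉ (suc (suc n)) = s≤s (s≤s (≤double⌈/2⌉ n))

double⌈/2⌉≤ : ∀ n → double ⌈ n /2⌉ ≤ suc n
double⌈/2⌉≤ 0             = z≤n
double⌈/2⌉≤ 1             = ≤-refl
double⌈/2⌉≤ (suc (suc n)) = s≤s (s≤s (double⌈/2⌉≤ n))

double-cancel-≤ : ∀ {a b} → double a ≤ double b → a ≤ b
double-cancel-≤ {zero}          _ = z≤n
double-cancel-≤ {suc a} {suc b} (s≤s (s≤s le)) = s≤s (double-cancel-≤ le)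

parity-double : ∀ c → parity (double c) ≡ 0ℙ
parity-double zero    = refl
parity-double (suc c) = parity-double c

parity-1+double : ∀ c → parity (suc (double c)) ≡ 1ℙ
parity-1+double zero    = refl
parity-1+double (suc c) = parity-1+double c

binary-double : ∀ c → 0 < c → binary (double c) ≡ binary c ++ (0 ∷ [])
binary-double c c>0 = begin
  binary (double c)                                         ≡⟨ binary-halve (double c) (subst (0 <_) (sym (double/2 c)) c>0) ⟩
  binary (double c / 2) ++ (double c % 2 ∷ [])              ≡⟨ cong₂ (λ h r → binary h ++ (r ∷ [])) (double/2 c) (double%2 c) ⟩
  binary c ++ (0 ∷ [])                                      ∎
  where open ≡-Reasoning

binary-1+double : ∀ c → 0 < c → binary (suc (double c)) ≡ binary c ++ (1 ∷ [])
binary-1+double c c>0 = begin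
  binary (suc (double c))                                   ≡⟨ binary-halve (suc (double c)) (subst (0 <_) (sym (1+double/2 c)) c>0) ⟩
  binary (suc (double c) / 2) ++ (suc (double c) % 2 ∷ [])  ≡⟨ cong₂ (λ h r → binary h ++ (r ∷ [])) (1+double/2 c) (1+double%2 c) ⟩
  binary c ++ (1 ∷ [])                                      ∎
  where open ≡-Reasoning

1≤length-binary : ∀ n → 1 ≤ length (binary n)
1≤length-binary 0 = s≤s z≤n
1≤length-binary 1 = s≤s z≤n
1≤length-binary n@(suc (suc _)) rewrite binary-halve n (m≥n⇒m/n>0 {n} (s≤s (s≤s z≤n))) | length-++ (binary (n / 2)) {n % 2 ∷ []} =
  m≤n+m 1 (length (binary (n / 2)))

2≤length-binary : ∀ n → 2 ≤ n → 2 ≤ length (binary n)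
2≤length-binary n@(suc (suc _)) _ rewrite binary-halve n (m≥n⇒m/n>0 {n} (s≤s (s≤s z≤n))) | length-++ (binary (n / 2)) {n % 2 ∷ []} =
  +-monoˡ-≤ 1 (1≤length-binary (n / 2))
2≤length-binary 1 (s≤s ())

starts10-++ : ∀ {xs} ys → 2 ≤ length xs → Starts10 (xs ++ ys) ⇔ Starts10 xs
starts10-++ {_ ∷ []} _ (s≤s ())
starts10-++ {x ∷ y ∷ zs} ys _ = mk⇔ (λ { (starts10 _) → starts10 _ }) (λ { (starts10 _) → starts10 _ })

starts10-snoc : ∀ {m c r} → 2 ≤ c → binary m ≡ binary c ++ r ∷ [] → Starts10 (binary m) ⇔ Starts10 (binary c)
starts10-snoc {c = c} 2≤c eq = subst (λ ds → Starts10 ds ⇔ Starts10 (binary c)) (sym eq) (starts10-++ _ (2≤length-binary c 2≤c))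

-- The last binary digit of k ∸ 1 is dropped by passing to ⌈ k /2⌉ ∸ 1.
starts10-⌈/2⌉ : ∀ k → 9 ≤ k → Starts10 (binary (k ∸ 1)) ⇔ Starts10 (binary (⌈ k /2⌉ ∸ 1))
starts10-⌈/2⌉ k 9≤k with evenOdd k
... | even (suc c) rewrite ⌊1+double/2⌋ c = starts10-snoc {suc (double c)} 2≤c (binary-1+double c (≤-trans (s≤s z≤n) 2≤c))
  where
  2≤c : 2 ≤ c
  2≤c = double-cancel-≤ (≤-trans (s≤s (s≤s (s≤s (s≤s z≤n)))) (s≤s⁻¹ (s≤s⁻¹ 9≤k)))
... | odd c rewrite ⌊double/2⌋ c = starts10-snoc {double c} 2≤c (binary-double c (≤-trans (s≤s z≤n) 2≤c))
  where
  2≤c : 2 ≤ c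
  2≤c = double-cancel-≤ (≤-trans (s≤s (s≤s (s≤s (s≤s z≤n)))) (s≤s⁻¹ 9≤k))

[1+n]%2≡1∸n%2 : ∀ n → (n + 1) % 2 ≡ 1 ∸ n % 2
[1+n]%2≡1∸n%2 n with n % 2 | m%n<n n 2 | %-distribˡ-+ n 1 2
... | 0 | _ | eq = eq
... | 1 | _ | eq = eq
... | suc (suc _) | s≤s (s≤s ()) | _

tm-double : ∀ c → tm (double c) ≡ tm c
tm-double zero        = refl
tm-double c@(suc _)   = begin
  sum (binary (double c)) % 2          ≡⟨ cong (λ ds → sum ds % 2) (binary-double c (s≤s z≤n)) ⟩
  sum (binary c ++ (0 ∷ [])) % 2       ≡⟨ cong (_% 2) (sum-++ (binary c) (0 ∷ [])) ⟩
  (sum (binary c) + 0) % 2             ≡⟨ cong (_% 2) (+-identityʳ (sum (binary c))) ⟩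
  tm c                                 ∎
  where open ≡-Reasoning

tm-1+double : ∀ c → tm (suc (double c)) ≡ 1 ∸ tm c
tm-1+double zero      = refl
tm-1+double c@(suc _) = begin
  sum (binary (suc (double c))) % 2    ≡⟨ cong (λ ds → sum ds % 2) (binary-1+double c (s≤s z≤n)) ⟩
  sum (binary c ++ (1 ∷ [])) % 2       ≡⟨ cong (_% 2) (sum-++ (binary c) (1 ∷ [])) ⟩
  (sum (binary c) + 1) % 2             ≡⟨ [1+n]%2≡1∸n%2 (sum (binary c)) ⟩
  1 ∸ tm c                             ∎
  where open ≡-Reasoning

tm≤1 : ∀ n → tm n ≤ 1
tm≤1 n = s≤s⁻¹ (m%n<n (sum (binary n)) 2)

1∸n≢n : ∀ n → 1 ∸ n ≢ n
1∸n≢n zero          ()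
1∸n≢n (suc zero)    ()
1∸n≢n (suc (suc n)) ()

1∸1∸b≡b : ∀ {b} → b ≤ 1 → 1 ∸ (1 ∸ b) ≡ b
1∸1∸b≡b z≤n       = refl
1∸1∸b≡b (s≤s z≤n) = refl

tm-1+double≡1∸tm-double : ∀ c → tm (suc (double c)) ≡ 1 ∸ tm (double c)
tm-1+double≡1∸tm-double c = trans (tm-1+double c) (cong (1 ∸_) (sym (tm-double c)))

tm-double≡1∸tm-1+double : ∀ c → tm (double c) ≡ 1 ∸ tm (suc (double c))
tm-double≡1∸tm-1+double c = trans (sym (1∸1∸b≡b (tm≤1 (double c)))) (cong (1 ∸_) (sym (tm-1+double≡1∸tm-double c)))

factor : ℕ → ℕ → Word
factor i zero    = []
factor i (suc m) = tm i ∷ factor (suc i) m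

map-applyUpTo≡factor : ∀ {h g : ℕ → ℕ} i m → (∀ j → h (g j) ≡ tm (i + j)) → map h (applyUpTo g m) ≡ factor i m
map-applyUpTo≡factor i zero    hg≗ = refl
map-applyUpTo≡factor i (suc m) hg≗ =
  cong₂ _∷_ (trans (hg≗ 0) (cong tm (+-identityʳ i)))
            (map-applyUpTo≡factor (suc i) m (λ j → trans (hg≗ (suc j)) (cong tm (+-suc i j))))

factorAt≡factor : ∀ i m → factorAt i m ≡ factor i m
factorAt≡factor i m = map-applyUpTo≡factor i m (λ _ → refl)

length-factor : ∀ i m → length (factor i m) ≡ m
length-factor i zero    = refl
length-factor i (suc m) = cong suc (length-factor (suc i) m)

factor-isSubword : ∀ i m → IsSubword (factor i m)
factor-isSubword i m = i , trans (cong (factorAt i) (length-factor i m)) (factorAt≡factor i m)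

isSubword-factor : ∀ {w} → IsSubword w → ∃ λ i → factor i (length w) ≡ w
isSubword-factor {w} (i , eq) = i , trans (sym (factorAt≡factor i (length w))) eq

isSubword-∷⁻ : ∀ {x w} → IsSubword (x ∷ w) → IsSubword w
isSubword-∷⁻ {x} {w} s with isSubword-factor s
... | i , eq = subst IsSubword (∷-injectiveʳ eq) (factor-isSubword (suc i) (length w))

take-factor : ∀ i {k m} → k ≤ m → take k (factor i m) ≡ factor i k
take-factor i {zero}          _         = refl
take-factor i {suc k} {suc m} (s≤s k≤m) = cong (tm i ∷_) (take-factor (suc i) k≤m)

factor-≗ : ∀ i j m → (∀ x → x < m → tm (i + x) ≡ tm (j + x)) → factor i m ≡ factor j m
factor-≗ i j zero    _  = refl
factor-≗ i j (suc m) eq =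
  cong₂ _∷_ (subst₂ (λ a b → tm a ≡ tm b) (+-identityʳ i) (+-identityʳ j) (eq 0 z<s))
            (factor-≗ (suc i) (suc j) m λ x x<m →
              subst₂ (λ a b → tm a ≡ tm b) (+-suc i x) (+-suc j x) (eq (suc x) (s<s x<m)))

factor-≗⁻ : ∀ i j m → factor i m ≡ factor j m → ∀ x → x < m → tm (i + x) ≡ tm (j + x)
factor-≗⁻ i j (suc m) eq zero    _         =
  subst₂ (λ a b → tm a ≡ tm b) (sym (+-identityʳ i)) (sym (+-identityʳ j)) (∷-injectiveˡ eq)
factor-≗⁻ i j (suc m) eq (suc x) (s≤s x<m) =
  subst₂ (λ a b → tm a ≡ tm b) (sym (+-suc i x)) (sym (+-suc j x)) (factor-≗⁻ (suc i) (suc j) m (∷-injectiveʳ eq) x x<m)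

μ : Word → Word
μ []      = []
μ (x ∷ w) = x ∷ 1 ∸ x ∷ μ w

length-μ : ∀ w → length (μ w) ≡ double (length w)
length-μ []      = refl
length-μ (x ∷ w) = cong (suc ∘ suc) (length-μ w)

factor-double : ∀ a m → factor (double a) (double m) ≡ μ (factor a m)
factor-double a zero    = refl
factor-double a (suc m) = cong₂ _∷_ (tm-double a) (cong₂ _∷_ (tm-1+double a) (factor-double (suc a) m))

double<2^[1+k]⇒<2^k : ∀ k r → double r < 2 ^ suc k → r < 2 ^ k
double<2^[1+k]⇒<2^k k r lt = *-cancelˡ-< 2 r (2 ^ k) (subst (_< 2 ^ suc k) (double≡2* r) lt)

2^[1+k]*q+double≡double : ∀ k q r → 2 ^ suc k * q + double r ≡ double (2 ^ k * q + r)
2^[1+k]*q+double≡double k q r = begin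
  2 * 2 ^ k * q + double r     ≡⟨ cong₂ _+_ (*-assoc 2 (2 ^ k) q) (double≡2* r) ⟩
  2 * (2 ^ k * q) + 2 * r      ≡⟨ *-distribˡ-+ 2 (2 ^ k * q) r ⟨
  2 * (2 ^ k * q + r)          ≡⟨ double≡2* (2 ^ k * q + r) ⟨
  double (2 ^ k * q + r)       ∎
  where open ≡-Reasoning

tm-block : ∀ k {q q′ r} → r < 2 ^ k → tm q ≡ tm q′ → tm (2 ^ k * q + r) ≡ tm (2 ^ k * q′ + r)
tm-block zero {q} {q′} {zero} _ eq = subst₂ (λ a b → tm a ≡ tm b) (sym (1*q+0 q)) (sym (1*q+0 q′)) eq
  where
  1*q+0 : ∀ q → 1 * q + 0 ≡ q
  1*q+0 q = trans (+-identityʳ (1 * q)) (*-identityˡ q)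
tm-block zero {r = suc _} (s≤s ()) _
tm-block (suc k) {q} {q′} {r} r< eq with evenOdd r
... | even r′ = begin
  tm (2 ^ suc k * q + double r′)   ≡⟨ cong tm (2^[1+k]*q+double≡double k q r′) ⟩
  tm (double (2 ^ k * q + r′))     ≡⟨ tm-double (2 ^ k * q + r′) ⟩
  tm (2 ^ k * q + r′)              ≡⟨ tm-block k (double<2^[1+k]⇒<2^k k r′ r<) eq ⟩
  tm (2 ^ k * q′ + r′)             ≡⟨ tm-double (2 ^ k * q′ + r′) ⟨
  tm (double (2 ^ k * q′ + r′))    ≡⟨ cong tm (2^[1+k]*q+double≡double k q′ r′) ⟨
  tm (2 ^ suc k * q′ + double r′)  ∎
  where open ≡-Reasoning
... | odd r′ = begin
  tm (2 ^ suc k * q + suc (double r′))   ≡⟨ cong tm (trans (+-suc _ (double r′)) (cong suc (2^[1+k]*q+double≡double k q r′))) ⟩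
  tm (suc (double (2 ^ k * q + r′)))     ≡⟨ tm-1+double (2 ^ k * q + r′) ⟩
  1 ∸ tm (2 ^ k * q + r′)                ≡⟨ cong (1 ∸_) (tm-block k (double<2^[1+k]⇒<2^k k r′ (<⇒≤ r<)) eq) ⟩
  1 ∸ tm (2 ^ k * q′ + r′)               ≡⟨ tm-1+double (2 ^ k * q′ + r′) ⟨
  tm (suc (double (2 ^ k * q′ + r′)))    ≡⟨ cong tm (trans (+-suc _ (double r′)) (cong suc (2^[1+k]*q+double≡double k q′ r′))) ⟨
  tm (2 ^ suc k * q′ + suc (double r′))  ∎
  where open ≡-Reasoning

tm-two-blocks : ∀ k {q q′ y} → y < 2 ^ k + 2 ^ k → tm q ≡ tm q′ → tm (suc q) ≡ tm (suc q′) →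
                tm (2 ^ k * q + y) ≡ tm (2 ^ k * q′ + y)
tm-two-blocks k {q} {q′} {y} y< e₀ e₁ with y <? 2 ^ k
... | yes y<P = tm-block k y<P e₀
... | no  y≮P = subst₂ (λ a b → tm a ≡ tm b) (next-block q) (next-block q′) (tm-block k s<P e₁)
  where
  P = 2 ^ k
  s = y ∸ P
  P+s≡y : P + s ≡ y
  P+s≡y = m+[n∸m]≡n (≮⇒≥ y≮P)
  s<P : s < P
  s<P = +-cancelˡ-< P s P (subst (_< P + P) (sym P+s≡y) y<)
  next-block : ∀ q → P * suc q + s ≡ P * q + y
  next-block q = begin
    P * suc q + s      ≡⟨ cong (_+ s) (trans (*-suc P q) (+-comm P (P * q))) ⟩
    P * q + P + s      ≡⟨ +-assoc (P * q) P s ⟩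
    P * q + (P + s)    ≡⟨ cong (P * q +_) P+s≡y ⟩
    P * q + y          ∎
    where open ≡-Reasoning

-- Positions 5, 0, 2, 1 of t carry the letter pairs 00, 01, 10, 11.
letter-pair-early : ∀ q → ∃ λ q′ → q′ ≤ 5 × tm q ≡ tm q′ × tm (suc q) ≡ tm (suc q′)
letter-pair-early q with tm q | tm≤1 q | tm (suc q) | tm≤1 (suc q)
... | 0 | z≤n     | 0 | z≤n     = 5 , ≤-refl , refl , refl
... | 0 | z≤n     | 1 | s≤s z≤n = 0 , z≤n , refl , refl
... | 1 | s≤s z≤n | 0 | z≤n     = 2 , s≤s (s≤s z≤n) , refl , refl
... | 1 | s≤s z≤n | 1 | s≤s z≤n = 1 , s≤s z≤n , refl , refl

factor-recurrence : ∀ k {m} i → m ≤ 2 ^ k → ∃ λ j → j < 6 * 2 ^ k × factor i m ≡ factor j m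
factor-recurrence k {m} i m≤P = shift (letter-pair-early q)
  where
  P = 2 ^ k
  instance
    P≢0 : NonZero P
    P≢0 = m^n≢0 2 k
  q = i / P
  r = i % P
  r<P : r < P
  r<P = m%n<n i P
  i≡ : i ≡ P * q + r
  i≡ = trans (m≡m%n+[m/n]*n i P) (trans (+-comm r (q * P)) (cong (_+ r) (*-comm q P)))
  shift : (∃ λ q′ → q′ ≤ 5 × tm q ≡ tm q′ × tm (suc q) ≡ tm (suc q′)) → ∃ λ j → j < 6 * P × factor i m ≡ factor j m
  shift (q′ , q′≤5 , e₀ , e₁) = P * q′ + r , j<6P , factor-≗ i (P * q′ + r) m same
    where
    j<6P : P * q′ + r < 6 * P
    j<6P = begin-strict
      P * q′ + r   <⟨ +-monoʳ-< (P * q′) r<P ⟩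
      P * q′ + P   ≤⟨ +-monoˡ-≤ P (*-monoʳ-≤ P q′≤5) ⟩
      P * 5 + P    ≡⟨ trans (+-comm (P * 5) P) (trans (sym (*-suc P 5)) (*-comm P 6)) ⟩
      6 * P        ∎
      where open ≤-Reasoning
    same : ∀ x → x < m → tm (i + x) ≡ tm (P * q′ + r + x)
    same x x<m = subst₂ (λ a b → tm a ≡ tm b)
      (sym (trans (cong (_+ x) i≡) (+-assoc (P * q) r x))) (sym (+-assoc (P * q′) r x))
      (tm-two-blocks k (+-mono-<-≤ r<P (≤-trans (<⇒≤ x<m) m≤P)) e₀ e₁)

module _ (k m : ℕ) (m≤2^k : m ≤ 2 ^ k) where

  all-factors : ∀ {P : Word → Set} → (∀ {j} → j < 6 * 2 ^ k → P (factor j m)) → ∀ i → P (factor i m)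
  all-factors {P} early i with factor-recurrence k i m≤2^k
  ... | j , j< , eq = subst P (sym eq) (early j<)

  all-factor-pairs : ∀ {R : Word → Word → Set} →
                     (∀ {j₁} → j₁ < 6 * 2 ^ k → ∀ {j₂} → j₂ < 6 * 2 ^ k → R (factor j₁ m) (factor j₂ m)) →
                     ∀ i₁ i₂ → R (factor i₁ m) (factor i₂ m)
  all-factor-pairs {R} early i₁ i₂ with factor-recurrence k i₁ m≤2^k | factor-recurrence k i₂ m≤2^k
  ... | j₁ , j₁< , eq₁ | j₂ , j₂< , eq₂ = subst₂ R (sym eq₁) (sym eq₂) (early j₁< j₂<)

no-000 : ∀ i → factor i 3 ≢ 0 ∷ 0 ∷ 0 ∷ []
no-000 = all-factors 2 3 (from-yes (3 ≤? 4)) {λ w → w ≢ 0 ∷ 0 ∷ 0 ∷ []} (from-yes (allUpTo? (λ j → ¬? (factor j 3 ≟w (0 ∷ 0 ∷ 0 ∷ []))) 24))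

Clash : Word → Word → Set
Clash u v = ∃ λ y → (u ≡ 1 ∷ 0 ∷ 0 ∷ y ⊎ u ≡ 0 ∷ 1 ∷ 0 ∷ y) × v ≡ 0 ∷ 0 ∷ 1 ∷ y

take-clash : ∀ k {u v} → Clash u v → Clash (take (3 + k) u) (take (3 + k) v)
take-clash k (y , inj₁ refl , refl) = take k y , inj₁ refl , refl
take-clash k (y , inj₂ refl , refl) = take k y , inj₂ refl , refl

no-clash-10 : ∀ i j → ¬ Clash (factor i 10) (factor j 10)
no-clash-10 i j c = all-factor-pairs 4 10 (from-yes (10 ≤? 16)) {λ u v → ¬ ClashPrefix u v}
  (from-yes (allUpTo? (λ j₁ → allUpTo? (λ j₂ → ¬? (clashPrefix? (factor j₁ 10) (factor j₂ 10))) 96) 96)) i j (clashPrefix c)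
  where
  ClashPrefix : Word → Word → Set
  ClashPrefix u v = (take 3 u ≡ 1 ∷ 0 ∷ 0 ∷ [] ⊎ take 3 u ≡ 0 ∷ 1 ∷ 0 ∷ []) × take 3 v ≡ 0 ∷ 0 ∷ 1 ∷ [] × drop 3 u ≡ drop 3 v
  clashPrefix? : ∀ u v → Dec (ClashPrefix u v)
  clashPrefix? u v = ((take 3 u ≟w _) ⊎-dec (take 3 u ≟w _)) ×-dec (take 3 v ≟w _) ×-dec (drop 3 u ≟w drop 3 v)
  clashPrefix : ∀ {u v} → Clash u v → ClashPrefix u v
  clashPrefix (_ , inj₁ refl , refl) = inj₁ refl , refl , refl
  clashPrefix (_ , inj₂ refl , refl) = inj₂ refl , refl , refl

no-clash : ∀ {n} i j → 10 ≤ n → ¬ Clash (factor i n) (factor j n)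
no-clash i j 10≤n c = no-clash-10 i j (subst₂ Clash (take-factor i 10≤n) (take-factor j 10≤n) (take-clash 7 c))

data HasRepeat : Word → Set where
  here  : ∀ {x y w} → x ≡ y → HasRepeat (x ∷ y ∷ w)
  there : ∀ {x w} → HasRepeat w → HasRepeat (x ∷ w)

hasRepeat? : ∀ w → Dec (HasRepeat w)
hasRepeat? []          = no λ ()
hasRepeat? (x ∷ [])    = no λ { (there ()) }
hasRepeat? (x ∷ y ∷ w) with x ≟ y | hasRepeat? (y ∷ w)
... | yes x≡y | _     = yes (here x≡y)
... | no _    | yes r = yes (there r)
... | no x≢y  | no ¬r = no λ { (here x≡y) → x≢y x≡y ; (there r) → ¬r r }

repeat-in-5-factor : ∀ i → HasRepeat (factor i 5)
repeat-in-5-factor = all-factors 3 5 (from-yes (5 ≤? 8)) {HasRepeat} (from-yes (allUpTo? (λ j → hasRepeat? (factor j 5)) 48))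

repeat-position : ∀ i m → HasRepeat (factor i m) → ∃ λ p → suc p < m × tm (i + p) ≡ tm (suc (i + p))
repeat-position i 1 (there ())
repeat-position i (suc (suc m)) (here eq) = 0 , s≤s (s≤s z≤n) , subst₂ (λ a b → tm a ≡ tm b) (sym (+-identityʳ i)) (cong suc (sym (+-identityʳ i))) eq
repeat-position i (suc (suc m)) (there r) with repeat-position (suc i) (suc m) r
... | p , p< , eq = suc p , s≤s p< , subst₂ (λ a b → tm a ≡ tm b) (sym (+-suc i p)) (cong suc (sym (+-suc i p))) eq

repeat⇒odd : ∀ x → tm x ≡ tm (suc x) → parity x ≡ 1ℙ
repeat⇒odd x eq with evenOdd x
... | even c = ⊥-elim (1∸n≢n (tm (double c)) (sym (trans eq (tm-1+double≡1∸tm-double c))))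
... | odd  c = parity-1+double c

factor-parity : ∀ {i j m} → 5 ≤ m → factor i m ≡ factor j m → parity i ≡ parity j
factor-parity {i} {j} {m} 5≤m eq with repeat-position i 5 (repeat-in-5-factor i)
... | p , p<4 , rep-i = ℙ.+-cancelʳ-≡ (parity p) (parity i) (parity j) (begin
  parity i ℙ+ parity p  ≡⟨ ℙ.+-homo-+ i p ⟨
  parity (i + p)        ≡⟨ repeat⇒odd (i + p) rep-i ⟩
  1ℙ                    ≡⟨ repeat⇒odd (j + p) rep-j ⟨
  parity (j + p)        ≡⟨ ℙ.+-homo-+ j p ⟩
  parity j ℙ+ parity p  ∎)
  where
  open ≡-Reasoning
  p<m   = ≤-trans (<⇒≤ p<4) 5≤m
  1+p<m = ≤-trans p<4 5≤m
  rep-j : tm (j + p) ≡ tm (suc (j + p))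
  rep-j = begin
    tm (j + p)        ≡⟨ factor-≗⁻ i j m eq p p<m ⟨
    tm (i + p)        ≡⟨ rep-i ⟩
    tm (suc (i + p))  ≡⟨ cong tm (+-suc i p) ⟨
    tm (i + suc p)    ≡⟨ factor-≗⁻ i j m eq (suc p) 1+p<m ⟩
    tm (j + suc p)    ≡⟨ cong tm (+-suc j p) ⟩
    tm (suc (j + p))  ∎

deleteFirst1 : Word → Word
deleteFirst1 []      = []
deleteFirst1 (1 ∷ w) = w
deleteFirst1 (x ∷ w) = x ∷ deleteFirst1 w

splitOn-nonempty : ∀ a w → ∃ λ A → ∃ λ As → splitOn a w ≡ A ∷ As
splitOn-nonempty a [] = _ , _ , refl
splitOn-nonempty a (x ∷ w) with does (x ≟ a) | splitOn a w
... | true  | _      = _ , _ , refl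
... | false | []     = _ , _ , refl
... | false | _ ∷ _  = _ , _ , refl

splitOn1-0∷ : ∀ w → splitOn 1 (0 ∷ w) ≡ (0 ∷ proj₁ (splitOn-nonempty 1 w)) ∷ proj₁ (proj₂ (splitOn-nonempty 1 w))
splitOn1-0∷ w with splitOn 1 w | splitOn-nonempty 1 w
... | _ | _ , _ , refl = refl

tortoiseBelow1-0∷ : ∀ w → tortoiseBelow 1 (0 ∷ w) ≡ 0 ∷ tortoiseBelow 1 w
tortoiseBelow1-0∷ w with splitOn 0 w | splitOn-nonempty 0 w
... | _ | _ , _ , refl = refl

tortoiseRest1-binary : ∀ {w} → All (_≤ 1) w → tortoiseRest 1 (splitOn 1 w) ≡ w ++ 1 ∷ []
tortoiseRest1-binary []                = refl
tortoiseRest1-binary (s≤s z≤n ∷ bits) = cong (1 ∷_) (tortoiseRest1-binary bits)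
tortoiseRest1-binary {0 ∷ w} (z≤n ∷ bits) rewrite splitOn1-0∷ w with splitOn-nonempty 1 w | tortoiseRest1-binary bits
... | A , As , eq | ih rewrite eq | tortoiseBelow1-0∷ A = cong (0 ∷_) ih

tortoiseBelow2-binary : ∀ {w} → All (_≤ 1) w → Any (_≡ 1) w → tortoiseBelow 2 w ≡ deleteFirst1 w ++ 1 ∷ []
tortoiseBelow2-binary (s≤s z≤n ∷ bits) _           = tortoiseRest1-binary bits
tortoiseBelow2-binary (z≤n ∷ _)        (here ())
tortoiseBelow2-binary {0 ∷ w} (z≤n ∷ bits) (there has1) rewrite splitOn1-0∷ w with splitOn-nonempty 1 w | tortoiseBelow2-binary bits has1
... | A , As , eq | ih rewrite eq | tortoiseBelow1-0∷ A = cong (0 ∷_) ih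

maxLetter≤1 : ∀ {w} → All (_≤ 1) w → maxLetter w ≤ 1
maxLetter≤1 []         = z≤n
maxLetter≤1 (b ∷ bits) = ⊔-lub b (maxLetter≤1 bits)

maxLetter-binary : ∀ {w} → All (_≤ 1) w → Any (_≡ 1) w → maxLetter w ≡ 1
maxLetter-binary (s≤s z≤n ∷ bits) _            = m≥n⇒m⊔n≡m (maxLetter≤1 bits)
maxLetter-binary (z≤n ∷ _)        (here ())
maxLetter-binary (z≤n ∷ bits)     (there has1) = maxLetter-binary bits has1

tortoise-binary : ∀ {w} → All (_≤ 1) w → Any (_≡ 1) w → tortoise w ≡ deleteFirst1 w ++ 1 ∷ []
tortoise-binary bits has1 rewrite maxLetter-binary bits has1 = tortoiseBelow2-binary bits has1

factor-binary : ∀ i m → All (_≤ 1) (factor i m)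
factor-binary i zero    = []
factor-binary i (suc m) = tm≤1 i ∷ factor-binary (suc i) m

data Shape : Word → Set where
  1∙   : ∀ r → Shape (1 ∷ r)
  01∙  : ∀ r → Shape (0 ∷ 1 ∷ r)
  001∙ : ∀ r → Shape (0 ∷ 0 ∷ 1 ∷ r)

factor-shape : ∀ i {m} → 3 ≤ m → Shape (factor i m)
factor-shape i {1} (s≤s ())
factor-shape i {2} (s≤s (s≤s ()))
factor-shape i {suc (suc (suc m))} _
  with tm i | tm≤1 i | tm (suc i) | tm≤1 (suc i) | tm (suc (suc i)) | tm≤1 (suc (suc i)) | no-000 i
... | 1 | s≤s z≤n | _ | _       | _ | _       | _   = 1∙ _
... | 0 | z≤n     | 1 | s≤s z≤n | _ | _       | _   = 01∙ _
... | 0 | z≤n     | 0 | z≤n     | 1 | s≤s z≤n | _   = 001∙ _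
... | 0 | z≤n     | 0 | z≤n     | 0 | z≤n     | ≢000 = ⊥-elim (≢000 refl)

shape-has1 : ∀ {w} → Shape w → Any (_≡ 1) w
shape-has1 (1∙ _)   = here refl
shape-has1 (01∙ _)  = there (here refl)
shape-has1 (001∙ _) = there (there (here refl))

data Swapped : Word → Word → Set where
  swapped : ∀ z → Swapped (0 ∷ 1 ∷ z) (1 ∷ 0 ∷ z)

deleteFirst1-collision : ∀ {u v} → Shape u → Shape v → deleteFirst1 u ≡ deleteFirst1 v →
                         u ≡ v ⊎ Swapped u v ⊎ Swapped v u ⊎ Clash u v ⊎ Clash v u
deleteFirst1-collision (1∙ r)   (1∙ .r)    refl = inj₁ refl
deleteFirst1-collision (1∙ ._)  (01∙ r)    refl = inj₂ (inj₂ (inj₁ (swapped r)))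
deleteFirst1-collision (1∙ ._)  (001∙ r)   refl = inj₂ (inj₂ (inj₂ (inj₁ (r , inj₁ refl , refl))))
deleteFirst1-collision (01∙ r)  (1∙ ._)    refl = inj₂ (inj₁ (swapped r))
deleteFirst1-collision (01∙ r)  (01∙ .r)   refl = inj₁ refl
deleteFirst1-collision (01∙ ._) (001∙ r)   refl = inj₂ (inj₂ (inj₂ (inj₁ (r , inj₂ refl , refl))))
deleteFirst1-collision (001∙ r) (1∙ ._)    refl = inj₂ (inj₂ (inj₂ (inj₂ (r , inj₁ refl , refl))))
deleteFirst1-collision (001∙ r) (01∙ ._)   refl = inj₂ (inj₂ (inj₂ (inj₂ (r , inj₂ refl , refl))))
deleteFirst1-collision (001∙ r) (001∙ .r)  refl = inj₁ refl

isSubword-binary : ∀ {w} → IsSubword w → All (_≤ 1) w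
isSubword-binary {w} s with isSubword-factor s
... | i , eq = subst (All (_≤ 1)) eq (factor-binary i (length w))

tortoise-factor : ∀ i {m} → 3 ≤ m → tortoise (factor i m) ≡ deleteFirst1 (factor i m) ++ 1 ∷ []
tortoise-factor i {m} 3≤m = tortoise-binary (factor-binary i m) (shape-has1 (factor-shape i 3≤m))

∼t-factors : ∀ i j {n} → 10 ≤ n → factor i n ∼t factor j n →
             factor i n ≡ factor j n ⊎ Swapped (factor i n) (factor j n) ⊎ Swapped (factor j n) (factor i n)
∼t-factors i j {n} 10≤n eq with deleteFirst1-collision (factor-shape i 3≤n) (factor-shape j 3≤n) erased-eq
  where
  3≤n = ≤-trans (s≤s (s≤s (s≤s z≤n))) 10≤n
  erased-eq = ++-cancelʳ (1 ∷ []) _ _ (trans (sym (tortoise-factor i 3≤n)) (trans eq (tortoise-factor j 3≤n)))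
... | inj₁ same                         = inj₁ same
... | inj₂ (inj₁ sw)                    = inj₂ (inj₁ sw)
... | inj₂ (inj₂ (inj₁ sw))             = inj₂ (inj₂ sw)
... | inj₂ (inj₂ (inj₂ (inj₁ clash)))   = ⊥-elim (no-clash i j 10≤n clash)
... | inj₂ (inj₂ (inj₂ (inj₂ clash)))   = ⊥-elim (no-clash j i 10≤n clash)

∼t-subwords : ∀ {n u v} → 10 ≤ n → SubwordOfLength n u → SubwordOfLength n v → u ∼t v → u ≡ v ⊎ Swapped u v ⊎ Swapped v u
∼t-subwords {n} {u} {v} 10≤n (lu , su) (lv , sv) u∼v with isSubword-factor su | isSubword-factor sv
... | i , fu | j , fv = subst₂ (λ a b → a ≡ b ⊎ Swapped a b ⊎ Swapped b a) eu ev
                          (∼t-factors i j 10≤n (subst₂ _∼t_ (sym eu) (sym ev) u∼v))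
  where
  eu : factor i n ≡ u
  eu = subst (λ m → factor i m ≡ u) lu fu
  ev : factor j n ≡ v
  ev = subst (λ m → factor j m ≡ v) lv fv

LeftSpecial : Word → Set
LeftSpecial z = IsSubword (0 ∷ z) × IsSubword (1 ∷ z)

Swappable : Word → Set
Swappable z = IsSubword (0 ∷ 1 ∷ z) × IsSubword (1 ∷ 0 ∷ z)

take-μ-injective : ∀ k {x y} → length x ≡ length y → double (length x) ≤ suc k → take k (μ x) ≡ take k (μ y) → x ≡ y
take-μ-injective k             {[]}    {[]}    _  _  _  = refl
take-μ-injective (suc zero)    {a ∷ []} {b ∷ []} _ _ eq = cong (_∷ []) (∷-injectiveˡ eq)
take-μ-injective (suc (suc k)) {a ∷ x} {b ∷ y} lx≡ly (s≤s (s≤s dx≤)) eq =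
  cong₂ _∷_ (∷-injectiveˡ eq) (take-μ-injective k (suc-injective lx≡ly) dx≤ (∷-injectiveʳ (∷-injectiveʳ eq)))
take-μ-injective (suc zero) {a ∷ _ ∷ _} {_} _ (s≤s (s≤s ())) _
take-μ-injective zero {_ ∷ _} _ (s≤s ()) _

factor-double-take : ∀ a {m} k → k ≤ double m → factor (double a) k ≡ take k (μ (factor a m))
factor-double-take a {m} k k≤ = trans (sym (take-factor (double a) k≤)) (cong (take k) (factor-double a m))

leftSpecial⇒swappable-μ : ∀ {z′} k → k ≤ double (length z′) → LeftSpecial z′ → Swappable (take k (μ z′))
leftSpecial⇒swappable-μ {z′} k k≤ (s0 , s1) = prefixed s0 , prefixed s1
  where
  prefixed : ∀ {x} → IsSubword (x ∷ z′) → IsSubword (x ∷ 1 ∸ x ∷ take k (μ z′))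
  prefixed {x} s with isSubword-factor s
  ... | a , eq = subst IsSubword (trans (factor-double-take a (2 + k) (s≤s (s≤s k≤))) (cong (take (2 + k) ∘ μ) eq))
                   (factor-isSubword (double a) (2 + k))

odd-occurrence-extends : ∀ c {x w} → factor (suc (double c)) (suc (length w)) ≡ x ∷ w → IsSubword (1 ∸ x ∷ x ∷ w)
odd-occurrence-extends c {x} {w} eq =
  subst IsSubword (cong₂ _∷_ (trans (tm-double≡1∸tm-1+double c) (cong (1 ∸_) (∷-injectiveˡ eq))) eq)
    (factor-isSubword (double c) (2 + length w))

leftSpecial⇒swappable : ∀ {z} → 5 ≤ length z → LeftSpecial z → Swappable z
leftSpecial⇒swappable {[]} () _
leftSpecial⇒swappable {z@(_ ∷ _)} 5≤k (s0 , s1) with isSubword-factor s0 | isSubword-factor s1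
... | a , fa | b , fb = go (evenOdd a) (evenOdd b) (factor-parity 5≤k tails) fa fb (∷-injectiveˡ tails)
  where
  tails = trans (∷-injectiveʳ fa) (sym (∷-injectiveʳ fb))
  -- Odd occurrences of 0z and 1z extend to 10z and 01z; even ones would give z two first letters.
  go : ∀ {a b} → EvenOdd a → EvenOdd b → parity (suc a) ≡ parity (suc b) →
       factor a (suc (length z)) ≡ 0 ∷ z → factor b (suc (length z)) ≡ 1 ∷ z → tm (suc a) ≡ tm (suc b) → Swappable z
  go (odd c)  (odd d)  _ fa fb _ = odd-occurrence-extends d fb , odd-occurrence-extends c fa
  go (even c) (even d) _ fa fb heads = ⊥-elim (0≢1+n (begin
    0                        ≡⟨⟩
    1 ∸ 1                    ≡⟨ cong (1 ∸_) (∷-injectiveˡ fb) ⟨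
    1 ∸ tm (double d)        ≡⟨ tm-1+double≡1∸tm-double d ⟨
    tm (suc (double d))      ≡⟨ heads ⟨
    tm (suc (double c))      ≡⟨ tm-1+double≡1∸tm-double c ⟩
    1 ∸ tm (double c)        ≡⟨ cong (1 ∸_) (∷-injectiveˡ fa) ⟩
    1                        ∎))
    where open ≡-Reasoning
  go (even c) (odd d)  p _ _ _ = ⊥-elim (ℙ.p≢p⁻¹ 0ℙ (trans (sym (parity-double d)) (trans (sym p) (parity-1+double c))))
  go (odd c)  (even d) p _ _ _ = ⊥-elim (ℙ.p≢p⁻¹ 0ℙ (trans (sym (parity-double c)) (trans p (parity-1+double d))))

swappable⇒μ-image : ∀ {z} → 5 ≤ length z → Swappable z →
                    ∃ λ z′ → length z′ ≡ ⌈ length z /2⌉ × LeftSpecial z′ × z ≡ take (length z) (μ z′)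
swappable⇒μ-image {[]} () _
swappable⇒μ-image {z@(_ ∷ _)} 5≤k (s01 , s10) with isSubword-factor s01 | isSubword-factor s10
... | i , fi | j , fj = go (evenOdd i) (evenOdd j) (factor-parity 5≤k tails) fi fj (∷-injectiveˡ tails)
  where
  k = length z
  h = ⌈ k /2⌉
  tails = trans (∷-injectiveʳ (∷-injectiveʳ fi)) (sym (∷-injectiveʳ (∷-injectiveʳ fj)))
  μ-image : ∀ c → factor (double (suc c)) k ≡ z → z ≡ take k (μ (factor (suc c) h))
  μ-image c eq = trans (sym eq) (factor-double-take (suc c) k (≤double⌈/2⌉ k))
  -- Even occurrences of 01z and 10z are μ-images of occurrences of 0z′ and 1z′;
  -- odd ones would give z two first letters.
  go : ∀ {i j} → EvenOdd i → EvenOdd j → parity i ≡ parity j →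
       factor i (2 + k) ≡ 0 ∷ 1 ∷ z → factor j (2 + k) ≡ 1 ∷ 0 ∷ z → tm (2 + i) ≡ tm (2 + j) →
       ∃ λ z′ → length z′ ≡ h × LeftSpecial z′ × z ≡ take k (μ z′)
  go (even a) (even b) _ fi fj _ =
    factor (suc a) h , length-factor (suc a) h ,
    (occurrence a (∷-injectiveˡ fi) refl , occurrence b (∷-injectiveˡ fj) (sym same)) , z≡
    where
    z≡ = μ-image a (∷-injectiveʳ (∷-injectiveʳ fi))
    same : factor (suc a) h ≡ factor (suc b) h
    same = take-μ-injective k (trans (length-factor (suc a) h) (sym (length-factor (suc b) h)))
             (subst (λ l → double l ≤ suc k) (sym (length-factor (suc a) h)) (double⌈/2⌉≤ k))
             (trans (sym z≡) (μ-image b (∷-injectiveʳ (∷-injectiveʳ fj))))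
    occurrence : ∀ c {x w} → tm (double c) ≡ x → factor (suc c) h ≡ w → IsSubword (x ∷ w)
    occurrence c tc eq = subst IsSubword (cong₂ _∷_ (trans (sym (tm-double c)) tc) eq) (factor-isSubword c (suc h))
  go (odd a) (odd b) _ fi fj heads = ⊥-elim (0≢1+n (begin
    0                               ≡⟨ cong (1 ∸_) (∷-injectiveˡ (∷-injectiveʳ fi)) ⟨
    1 ∸ tm (double (suc a))         ≡⟨ tm-1+double≡1∸tm-double (suc a) ⟨
    tm (suc (double (suc a)))       ≡⟨ heads ⟩
    tm (suc (double (suc b)))       ≡⟨ tm-1+double≡1∸tm-double (suc b) ⟩
    1 ∸ tm (double (suc b))         ≡⟨ cong (1 ∸_) (∷-injectiveˡ (∷-injectiveʳ fj)) ⟩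
    1                               ∎))
    where open ≡-Reasoning
  go (even a) (odd b)  p _ _ _ = ⊥-elim (ℙ.p≢p⁻¹ 0ℙ (trans (sym (parity-double a)) (trans p (parity-1+double b))))
  go (odd a)  (even b) p _ _ _ = ⊥-elim (ℙ.p≢p⁻¹ 0ℙ (trans (sym (parity-double b)) (trans (sym p) (parity-1+double a))))

SwappableOfLength : ℕ → Word → Set
SwappableOfLength k z = length z ≡ k × Swappable z

swappable-μ-image : ∀ {k z} → 9 ≤ k → SwappableOfLength k z ⇔ (∃ λ z′ → SwappableOfLength ⌈ k /2⌉ z′ × z ≡ take k (μ z′))
swappable-μ-image {k} {z} 9≤k = mk⇔ to from
  where
  5≤⌈k/2⌉ : 5 ≤ ⌈ k /2⌉
  5≤⌈k/2⌉ = ⌈n/2⌉-mono 9≤k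
  to : SwappableOfLength k z → ∃ λ z′ → SwappableOfLength ⌈ k /2⌉ z′ × z ≡ take k (μ z′)
  to (refl , sw) with swappable⇒μ-image (≤-trans (s≤s (s≤s (s≤s (s≤s (s≤s z≤n))))) 9≤k) sw
  ... | z′ , lz′ , ls , eq = z′ , (lz′ , leftSpecial⇒swappable (subst (5 ≤_) (sym lz′) 5≤⌈k/2⌉) ls) , eq
  from : (∃ λ z′ → SwappableOfLength ⌈ k /2⌉ z′ × z ≡ take k (μ z′)) → SwappableOfLength k z
  from (z′ , (lz′ , s01 , s10) , refl) =
    trans (length-take k (μ z′)) (m≤n⇒m⊓n≡m k≤) ,
    leftSpecial⇒swappable-μ k (subst (λ l → k ≤ double l) (sym lz′) (≤double⌈/2⌉ k)) (isSubword-∷⁻ s10 , isSubword-∷⁻ s01)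
    where
    k≤ : k ≤ length (μ z′)
    k≤ = subst (k ≤_) (sym (trans (length-μ z′) (cong double lz′))) (≤double⌈/2⌉ k)

enumerates-μ-image : ∀ {k zs} → 9 ≤ k → Enumerates (SwappableOfLength ⌈ k /2⌉) zs →
                     Enumerates (SwappableOfLength k) (map (take k ∘ μ) zs)
enumerates-μ-image {k} {zs} 9≤k (unique , members) = unique′ , members′
  where
  unique′ : Unique (map (take k ∘ μ) zs)
  unique′ = AllPairs.map⁺ (AllPairs-mapWithAll (All.tabulate (λ {z} → proj₁ (members z))) unique
    λ (lx , _) (ly , _) x≢y eq → x≢y (take-μ-injective k (trans lx (sym ly))
                                      (subst (λ l → double l ≤ suc k) (sym lx) (double⌈/2⌉≤ k)) eq))
  members′ : ∀ w → (w ∈ map (take k ∘ μ) zs → SwappableOfLength k w) × (SwappableOfLength k w → w ∈ map (take k ∘ μ) zs)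
  members′ w = (λ w∈ → let z′ , z′∈ , eq = ∈-map⁻ (take k ∘ μ) w∈ in
                         Equivalence.from (swappable-μ-image 9≤k) (z′ , proj₁ (members z′) z′∈ , eq))
             , (λ sw → let z′ , sw′ , eq = Equivalence.to (swappable-μ-image 9≤k) sw in
                         subst (_∈ map (take k ∘ μ) zs) (sym eq) (∈-map⁺ (take k ∘ μ) (proj₂ (members z′) sw′)))

SwapCount : ℕ → ℕ → Set
SwapCount k c = (Starts10 (binary (k ∸ 1)) → c ≡ 4) × (¬ Starts10 (binary (k ∸ 1)) → c ≡ 2)

SwappableCensus : ℕ → Set
SwappableCensus k = ∃ λ zs → Enumerates (SwappableOfLength k) zs × SwapCount k (length zs)

swappableTable : ℕ → List Word
swappableTable 5 = (0 ∷ 1 ∷ 1 ∷ 0 ∷ 0 ∷ []) ∷ (0 ∷ 1 ∷ 1 ∷ 0 ∷ 1 ∷ []) ∷ (1 ∷ 0 ∷ 0 ∷ 1 ∷ 0 ∷ []) ∷ (1 ∷ 0 ∷ 0 ∷ 1 ∷ 1 ∷ []) ∷ []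
swappableTable 6 = (0 ∷ 1 ∷ 1 ∷ 0 ∷ 0 ∷ 1 ∷ []) ∷ (0 ∷ 1 ∷ 1 ∷ 0 ∷ 1 ∷ 0 ∷ []) ∷ (1 ∷ 0 ∷ 0 ∷ 1 ∷ 0 ∷ 1 ∷ []) ∷ (1 ∷ 0 ∷ 0 ∷ 1 ∷ 1 ∷ 0 ∷ []) ∷ []
swappableTable 7 = (0 ∷ 1 ∷ 1 ∷ 0 ∷ 1 ∷ 0 ∷ 0 ∷ []) ∷ (1 ∷ 0 ∷ 0 ∷ 1 ∷ 0 ∷ 1 ∷ 1 ∷ []) ∷ []
swappableTable 8 = (0 ∷ 1 ∷ 1 ∷ 0 ∷ 1 ∷ 0 ∷ 0 ∷ 1 ∷ []) ∷ (1 ∷ 0 ∷ 0 ∷ 1 ∷ 0 ∷ 1 ∷ 1 ∷ 0 ∷ []) ∷ []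
swappableTable _ = []

module SwappableTable (k : ℕ) (k≤8 : k ≤ 8) where

  OccursBefore : ℕ → Word → Set
  OccursBefore B w = ∃ λ i → i < B × factor i (length w) ≡ w

  SwapPair : Word → Word → Set
  SwapPair u v = take 2 u ≡ 0 ∷ 1 ∷ [] × take 2 v ≡ 1 ∷ 0 ∷ [] × drop 2 u ≡ drop 2 v

  Certificate : Set
  Certificate = Unique (swappableTable k) ×
    All (λ z → length z ≡ k × OccursBefore 96 (0 ∷ 1 ∷ z) × OccursBefore 96 (1 ∷ 0 ∷ z)) (swappableTable k) ×
    (∀ {j₁} → j₁ < 96 → ∀ {j₂} → j₂ < 96 → SwapPair (factor j₁ (2 + k)) (factor j₂ (2 + k)) →
       drop 2 (factor j₁ (2 + k)) ∈ swappableTable k)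

  table-certificate? : Dec Certificate
  table-certificate? = unique? (swappableTable k)
    ×-dec All.all? (λ z → (length z ≟ k) ×-dec occursBefore? _ ×-dec occursBefore? _) (swappableTable k)
    ×-dec allUpTo? (λ j₁ → allUpTo? (λ j₂ → swapPair? (factor j₁ (2 + k)) (factor j₂ (2 + k))
                                              →-dec (drop 2 (factor j₁ (2 + k)) ∈? swappableTable k)) 96) 96
    where
    occursBefore? : ∀ w → Dec (OccursBefore 96 w)
    occursBefore? w = anyUpTo? (λ i → factor i (length w) ≟w w) 96
    swapPair? : ∀ u v → Dec (SwapPair u v)
    swapPair? u v = (take 2 u ≟w _) ×-dec (take 2 v ≟w _) ×-dec (drop 2 u ≟w drop 2 v)

  table-enumerates : Certificate → Enumerates (SwappableOfLength k) (swappableTable k)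
  table-enumerates (unique , early , complete) = unique , λ z → sound z , complete′ z
    where
    sound : ∀ z → z ∈ swappableTable k → SwappableOfLength k z
    sound z z∈ with All.lookup early z∈
    ... | lz , (i , _ , e₀₁) , (j , _ , e₁₀) = lz , (i , trans (factorAt≡factor i _) e₀₁) , (j , trans (factorAt≡factor j _) e₁₀)
    complete′ : ∀ z → SwappableOfLength k z → z ∈ swappableTable k
    complete′ z (refl , s01 , s10) with isSubword-factor s01 | isSubword-factor s10
    ... | i , fi | j , fj = subst₂ (λ u v → SwapPair u v → drop 2 u ∈ swappableTable k) fi fj
                              (all-factor-pairs 4 (2 + k) (≤-trans (s≤s (s≤s k≤8)) (from-yes (10 ≤? 16))) {λ u v → SwapPair u v → drop 2 u ∈ swappableTable k} complete i j)
                              (refl , refl , refl)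

open SwappableTable using (table-enumerates; table-certificate?)

table-census : ∀ k → 5 ≤ k → k ≤ 8 → SwappableCensus k
table-census 5 _ k≤8 = swappableTable 5 , table-enumerates 5 k≤8 (from-yes (table-certificate? 5 k≤8)) , (λ _ → refl) , (λ ¬s → ⊥-elim (¬s (starts10 _)))
table-census 6 _ k≤8 = swappableTable 6 , table-enumerates 6 k≤8 (from-yes (table-certificate? 6 k≤8)) , (λ _ → refl) , (λ ¬s → ⊥-elim (¬s (starts10 _)))
table-census 7 _ k≤8 = swappableTable 7 , table-enumerates 7 k≤8 (from-yes (table-certificate? 7 k≤8)) , (λ ()) , (λ _ → refl)
table-census 8 _ k≤8 = swappableTable 8 , table-enumerates 8 k≤8 (from-yes (table-certificate? 8 k≤8)) , (λ ()) , (λ _ → refl)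
table-census (suc (suc (suc (suc (suc (suc (suc (suc (suc _))))))))) _ (s≤s (s≤s (s≤s (s≤s (s≤s (s≤s (s≤s (s≤s ()))))))))
table-census 0 () _
table-census 1 (s≤s ()) _
table-census 2 (s≤s (s≤s ())) _
table-census 3 (s≤s (s≤s (s≤s ()))) _
table-census 4 (s≤s (s≤s (s≤s (s≤s ())))) _

⌈/2⌉<  : ∀ {k} → 2 ≤ k → ⌈ k /2⌉ < k
⌈/2⌉< {1}           (s≤s ())
⌈/2⌉< {suc (suc k)} _ = ⌈n/2⌉<n k

μ-image-census : ∀ {k} → 9 ≤ k → SwappableCensus ⌈ k /2⌉ → SwappableCensus k
μ-image-census {k} 9≤k (zs , enum , count₄ , count₂) =
  map (take k ∘ μ) zs , enumerates-μ-image 9≤k enum ,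
  (λ s  → trans (length-map _ zs) (count₄ (Equivalence.to (starts10-⌈/2⌉ k 9≤k) s))) ,
  (λ ¬s → trans (length-map _ zs) (count₂ (¬s ∘ Equivalence.from (starts10-⌈/2⌉ k 9≤k))))

swappable-census : ∀ k → 5 ≤ k → SwappableCensus k
swappable-census = <-rec (λ k → 5 ≤ k → SwappableCensus k) census
  where
  census : ∀ k → (∀ {h} → h < k → 5 ≤ h → SwappableCensus h) → 5 ≤ k → SwappableCensus k
  census k rec 5≤k with k ≤? 8
  ... | yes k≤8 = table-census k 5≤k k≤8
  ... | no  k≰8 = μ-image-census 9≤k (rec (⌈/2⌉< (≤-trans (s≤s (s≤s z≤n)) 9≤k)) (⌈n/2⌉-mono 9≤k))
    where
    9≤k = ≰⇒> k≰8

n≤2^n : ∀ n → n ≤ 2 ^ n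
n≤2^n zero    = z≤n
n≤2^n (suc n) = subst (suc n ≤_) (cong (2 ^ n +_) (sym (+-identityʳ (2 ^ n)))) (+-mono-≤ (m^n>0 2 n) (n≤2^n n))

subword-enumeration : ∀ n → ∃ λ L → Enumerates (SubwordOfLength n) L
subword-enumeration n = L , deduplicate-! early , members
  where
  early = map (λ j → factor j n) (upTo (6 * 2 ^ n))
  L = deduplicate _≟w_ early
  members : ∀ w → (w ∈ L → SubwordOfLength n w) × (SubwordOfLength n w → w ∈ L)
  members w = (λ w∈ → let j , _ , eq = ∈-map⁻ (λ j → factor j n) (∈-deduplicate⁻ _≟w_ early w∈) in
                         subst (SubwordOfLength n) (sym eq) (length-factor j n , factor-isSubword j n))
            , (λ (lw , s) → let i , eq = isSubword-factor s
                                j , j< , eq′ = factor-recurrence n i (n≤2^n n) in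
                         ∈-deduplicate⁺ _≟w_ (subst (_∈ early) (trans (sym eq′) (subst (λ m → factor i m ≡ w) lw eq))
                           (∈-map⁺ (λ j → factor j n) (∈-upTo⁺ j<))))

swapped-∼t : ∀ {z} → All (_≤ 1) z → (1 ∷ 0 ∷ z) ∼t (0 ∷ 1 ∷ z)
swapped-∼t bits = trans (tortoise-binary (s≤s z≤n ∷ z≤n ∷ bits) (here refl))
                        (sym (tortoise-binary (z≤n ∷ s≤s z≤n ∷ bits) (there (here refl))))

module TortoiseClasses {k L zs} (8≤k : 8 ≤ k) (subwords : Enumerates (SubwordOfLength (2 + k)) L)
                       (swappables : Enumerates (SwappableOfLength k) zs) where

  -- 10z is redundant when z is swappable: it is tortoise-equivalent to 01z.
  Redundant : Word → Set
  Redundant w = take 2 w ≡ 1 ∷ 0 ∷ [] × drop 2 w ∈ zs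

  redundant? : Decidable Redundant
  redundant? w = (take 2 w ≟w _) ×-dec (drop 2 w ∈? zs)

  redundant-form : ∀ {w} → Redundant w → w ≡ 1 ∷ 0 ∷ drop 2 w
  redundant-form {w} (t , _) = trans (sym (take++drop≡id 2 w)) (cong (_++ drop 2 w) t)

  representatives : List Word
  representatives = filter (¬? ∘ redundant?) L

  swappable-subwords : ∀ {z} → z ∈ zs → SubwordOfLength (2 + k) (0 ∷ 1 ∷ z) × SubwordOfLength (2 + k) (1 ∷ 0 ∷ z)
  swappable-subwords z∈ with proj₁ (proj₂ swappables _) z∈
  ... | lz , s01 , s10 = (cong (suc ∘ suc) lz , s01) , (cong (suc ∘ suc) lz , s10)

  good : All (λ w → SubwordOfLength (2 + k) w × ¬ Redundant w) representatives
  good = All.tabulate λ {w} w∈ → let w∈L , ¬r = ∈-filter⁻ (¬? ∘ redundant?) {xs = L} w∈ in proj₁ (proj₂ subwords w) w∈L , ¬r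

  inequivalent : AllPairs (λ u v → ¬ u ∼t v) representatives
  inequivalent = AllPairs-mapWithAll good (AllPairs.filter⁺ (¬? ∘ redundant?) (proj₁ subwords)) separate
    where
    separate : ∀ {u v} → SubwordOfLength (2 + k) u × ¬ Redundant u → SubwordOfLength (2 + k) v × ¬ Redundant v →
               u ≢ v → ¬ u ∼t v
    separate (su , ¬ru) (sv , ¬rv) u≢v u∼v with ∼t-subwords (s≤s (s≤s 8≤k)) su sv u∼v
    ... | inj₁ u≡v                = u≢v u≡v
    ... | inj₂ (inj₁ (swapped z)) = ¬rv (refl , proj₂ (proj₂ swappables z) (suc-injective (suc-injective (proj₁ su)) , proj₂ su , proj₂ sv))
    ... | inj₂ (inj₂ (swapped z)) = ¬ru (refl , proj₂ (proj₂ swappables z) (suc-injective (suc-injective (proj₁ sv)) , proj₂ sv , proj₂ su))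

  covering : ∀ w → SubwordOfLength (2 + k) w → Any (w ∼t_) representatives
  covering w sw with redundant? w
  ... | no ¬r = Any.map (cong tortoise) (∈-filter⁺ (¬? ∘ redundant?) (proj₂ (proj₂ subwords w) sw) ¬r)
  ... | yes r@(_ , z∈) = Any.map (λ eq → trans w∼01z (cong tortoise eq))
                           (∈-filter⁺ (¬? ∘ redundant?) (proj₂ (proj₂ subwords _) s01) λ ())
    where
    s01 = proj₁ (swappable-subwords z∈)
    w∼01z : w ∼t (0 ∷ 1 ∷ drop 2 w)
    w∼01z = trans (cong tortoise (redundant-form r)) (swapped-∼t (All-drop⁺ 2 (isSubword-binary (proj₂ sw))))

  redundant-count : length (filter redundant? L) ≡ length zs
  redundant-count = trans (unique-same-members⇒length≡ (Unique.filter⁺ redundant? (proj₁ subwords))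
                             (Unique.map⁺ (∷-injectiveʳ ∘ ∷-injectiveʳ) (proj₁ swappables)) (mk⇔ to from))
                          (length-map _ zs)
    where
    to : ∀ {w} → w ∈ filter redundant? L → w ∈ map (λ z → 1 ∷ 0 ∷ z) zs
    to {w} w∈ = let _ , r = ∈-filter⁻ redundant? {xs = L} w∈ in
                subst (_∈ map _ zs) (sym (redundant-form r)) (∈-map⁺ _ (proj₂ r))
    from : ∀ {w} → w ∈ map (λ z → 1 ∷ 0 ∷ z) zs → w ∈ filter redundant? L
    from w∈ with ∈-map⁻ _ w∈
    ... | z , z∈ , refl = ∈-filter⁺ redundant? (proj₂ (proj₂ subwords _) (proj₂ (swappable-subwords z∈))) (refl , z∈)

  complexity : TortoiseComplexity (2 + k) (length L ∸ length zs)
  complexity = representatives , All.map proj₁ good , inequivalent , covering ,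
               trans (length-filter-∁ redundant? L) (cong (length L ∸_) redundant-count)

theorem6 : ∀ (n : ℕ) → 10 ≤ n →
    Σ ℕ λ ρ → Σ ℕ λ ρt →
      SubwordComplexity n ρ × TortoiseComplexity n ρt ×
      (Starts10 (binary (n ∸ 3)) → ρt ≡ ρ ∸ 4) ×
      (¬ Starts10 (binary (n ∸ 3)) → ρt ≡ ρ ∸ 2)
theorem6 (suc (suc k)) (s≤s (s≤s 8≤k)) =
  let L , subwords = subword-enumeration (2 + k)
      zs , swappables , count₄ , count₂ = swappable-census k (≤-trans (from-yes (5 ≤? 8)) 8≤k)
  in length L , length L ∸ length zs ,
     (L , proj₁ subwords , proj₂ subwords , refl) ,
     TortoiseClasses.complexity 8≤k subwords swappables ,
     (λ s → cong (length L ∸_) (count₄ s)) , (λ ¬s → cong (length L ∸_) (count₂ ¬s))
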